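{- Let $j \in \mathbb{N}_0$ be such that either $j = 0$ or $j$ is not a multiple of $10$, let $c \in \mathbb{Z}^+$, and set $a := j \cdot 10^c$. Then for every $b \in \mathbb{Z}^+$, $$V(a,b)=\begin{cases} 0 & \text{if } j=0,\\ c & \text{if } j\neq 0 \text{ and } b=1,\\ c\cdot\left({}^{b-1}(j\cdot 10^c)-{}^{b-2}(j\cdot 10^c)\right) & \text{if } j\neq 0 \text{ and } b\ge 2.\end{cases}$$
   Context: Tetration is defined for non-negative integers $a,b$ by ${}^{0}a = 1$ and ${}^{b}a = a^{({}^{b-1}a)}$ for $b \ge 1$, with the convention $0^0 = 1$ (so ${}^{b}0 = 1$ for even $b$ and ${}^{b}0=0$ for odd $b$). All numbers are written in base $10$. For distinct non-negative integers $x,y$, let $\ell(x,y)$ denote the number of rightmost decimal digits on which $x$ and $y$ agree, i.e. the largest $n \ge 0$ such that $x \equiv y \pmod{10^n}$. For a non-negative integer $a$ and $b \in \mathbb{Z}^+$, the congruence speed of ${}^{b}a$ is $V(a,b) := \ell({}^{b}a, {}^{b+1}a) - \ell({}^{b-1}a, {}^{b}a)$, i.e. the number of rightmost digits of ${}^{b}a$ that coincide with those of ${}^{b+1}a$ minus the number of rightmost digits of ${}^{b-1}a$ that coincide with those of ${}^{b}a$. -}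

module Defs where

open import Data.Nat using (ℕ; zero; suc; _^_; _*_; _≤_)
open import Data.Integer as ℤ using (ℤ; +_; _-_)
open import Data.Integer.Divisibility using () renaming (_∣_ to _∣ℤ_)
open import Data.Product using (Σ; _×_)
open import Data.Empty using (⊥)
open import Relation.Binary.PropositionalEquality using (_≡_)

-- Tetration: tet b a = ^b a, with tet 0 a = 1 and tet (b+1) a = a ^ (tet b a).
-- Agda's _^_ satisfies 0 ^ 0 = 1, matching the paper's convention.
tet : ℕ → ℕ → ℕ
tet zero    a = 1
tet (suc b) a = a ^ tet b a

AgreeMod : ℕ → ℕ → ℕ → Set
AgreeMod n x y = (+ (10 ^ n)) ∣ℤ (+ x - + y)

IsEll : ℕ → ℕ → ℕ → Set
IsEll x y n = AgreeMod n x y × (∀ m → AgreeMod m x y → m ≤ n)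

-- IsV a b v : v = V(a,b) = ℓ(^b a, ^(b+1) a) - ℓ(^(b-1) a, ^b a), for b = suc b'.
-- (ℓ is given by its defining property; the witnesses are unique by maximality.)
IsV : ℕ → ℕ → ℤ → Set
IsV a zero v = ⊥   -- V(a,0) is not defined (b ∈ ℤ⁺)
IsV a (suc b') v =
  Σ ℕ λ n₁ → Σ ℕ λ n₂ →
    IsEll (tet (suc b') a) (tet (suc (suc b')) a) n₁ ×
    IsEll (tet b' a) (tet (suc b') a) n₂ ×
    (v ≡ (+ n₁ - + n₂))

Vformula : ℕ → ℕ → ℕ → ℤ
Vformula zero    c b                = + 0
Vformula (suc _) c zero             = + 0   -- b = 0 never used (b ∈ ℤ⁺)
Vformula (suc _) c (suc zero)       = + c
Vformula j@(suc _) c (suc (suc b'')) =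
  (+ c) ℤ.* (+ tet (suc b'') (j * 10 ^ c) - + tet b'' (j * 10 ^ c))

-- For a = j·10^c with 10 ∤ j and c ≥ 1, every power a^S is 10^(cS)·j^S with 10 ∤ j^S,
-- while a^T is divisible by 10^(cS+1) whenever S < T; hence a^S and a^T share exactly
-- cS trailing digits. Since ^k a = a^(^(k-1) a) and the exponents 0 < 1 < a < ^2 a < …
-- strictly increase, ℓ(^k a, ^(k+1) a) = c·^(k-1) a, and V(a,b) is c times the difference
-- of two consecutive exponents. For j = 0 the tower alternates between 1 and 0, so every
-- ℓ vanishes.
module Submission where

open import Defs
open import Algebra.Properties.CommutativeSemigroup using (x∙yz≈y∙xz)
open import Data.Empty using (⊥-elim)
open import Data.Integer using (+_; _-_)
import Data.Integer as ℤ
open import Data.Integer.Divisibility using () renaming (_∣_ to _∣ᵤ_)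
open import Data.Integer.Divisibility.Signed as Signed using (∣ᵤ⇒∣; ∣⇒∣ᵤ)
import Data.Integer.Properties as ℤP
open import Data.Nat using (ℕ; zero; suc; _+_; _*_; _^_; _∸_; _≤_; _<_; z≤n; s≤s; _≤?_)
open import Data.Nat.Divisibility
  using (_∣_; divides; ∣-trans; ∣n⇒∣m*n; ∣m⇒∣m*n; m∣m*n; _∣0; 1∣_; ∣1⇒≡1; >⇒∤; *-monoʳ-∣; *-cancelˡ-∣; module ∣-Reasoning)
open import Data.Nat.LCM using (lcm-least)
open import Data.Nat.Primality using (Prime; euclidsLemma; ¬prime[1]; prime[2]; prime?)
open import Data.Nat.Properties
open import Data.Product using (_,_)
open import Data.Sum using (_⊎_; inj₁; inj₂)
open import Function using (_∘_)
open import Relation.Binary.PropositionalEquality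
  using (_≡_; refl; sym; trans; cong; cong₂; subst; module ≡-Reasoning)
open import Relation.Nullary using (¬_; yes; no)
open import Relation.Nullary.Decidable using (from-yes)

^-distribʳ-* : ∀ m n o → (m * n) ^ o ≡ m ^ o * n ^ o
^-distribʳ-* m n zero    = refl
^-distribʳ-* m n (suc o) = begin
  m * n * (m * n) ^ o       ≡⟨ cong (m * n *_) (^-distribʳ-* m n o) ⟩
  m * n * (m ^ o * n ^ o)   ≡⟨ *-assoc m n _ ⟩
  m * (n * (m ^ o * n ^ o)) ≡⟨ cong (m *_) (x∙yz≈y∙xz *-commutativeSemigroup n (m ^ o) (n ^ o)) ⟩
  m * (m ^ o * (n * n ^ o)) ≡⟨ *-assoc m (m ^ o) _ ⟨
  m * m ^ o * (n * n ^ o)   ∎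
  where open ≡-Reasoning

^-monoʳ-∣ : ∀ m {n o} → n ≤ o → m ^ n ∣ m ^ o
^-monoʳ-∣ m {o = o} z≤n = 1∣ (m ^ o)
^-monoʳ-∣ m (s≤s n≤o)   = *-monoʳ-∣ m (^-monoʳ-∣ m n≤o)

n<m^n : ∀ m → 1 < m → ∀ n → n < m ^ n
n<m^n m 1<m zero    = s≤s z≤n
n<m^n m 1<m (suc n) = ≤-<-trans (n<m^n m 1<m n) (^-monoʳ-< m 1<m (n<1+n n))

prime∣m^n⇒prime∣m : ∀ {p} m n → Prime p → p ∣ m ^ n → p ∣ m
prime∣m^n⇒prime∣m m zero    p-prime p∣1 with ∣1⇒≡1 p∣1
... | refl = ⊥-elim (¬prime[1] p-prime)
prime∣m^n⇒prime∣m m (suc n) p-prime p∣m*m^n with euclidsLemma m (m ^ n) p-prime p∣m*m^n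
... | inj₁ p∣m   = p∣m
... | inj₂ p∣m^n = prime∣m^n⇒prime∣m m n p-prime p∣m^n

10∣m^n⇒10∣m : ∀ m n → 10 ∣ m ^ n → 10 ∣ m
10∣m^n⇒10∣m m n 10∣m^n = lcm-least (prime∣m^n⇒prime∣m m n prime[2] (∣-trans (divides 5 refl) 10∣m^n))
                                   (prime∣m^n⇒prime∣m m n (from-yes (prime? 5)) (∣-trans (divides 2 refl) 10∣m^n))

∤-minus-multiple : ∀ {d m n} → ¬ d ∣ m → d ∣ n → ¬ (+ d ∣ᵤ + m - + n)
∤-minus-multiple {d} {m} {n} d∤m d∣n d∣m-n =
  d∤m (∣⇒∣ᵤ (Signed.∣m+n∣n⇒∣m {+ d} {+ m} (∣ᵤ⇒∣ d∣m-n) (Signed.∣m⇒∣-m (∣ᵤ⇒∣ {+ d} {+ n} d∣n))))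

pos-*-distribˡ-minus : ∀ c m n → + c ℤ.* (+ m - + n) ≡ + (c * m) - + (c * n)
pos-*-distribˡ-minus c m n = begin
  + c ℤ.* (+ m - + n)                    ≡⟨ ℤP.*-distribˡ-+ (+ c) (+ m) (ℤ.- + n) ⟩
  + c ℤ.* + m ℤ.+ + c ℤ.* ℤ.- (+ n)      ≡⟨ cong (ℤ._+_ (+ c ℤ.* + m)) (ℤP.neg-distribʳ-* (+ c) (+ n)) ⟨
  + c ℤ.* + m - + c ℤ.* + n              ≡⟨ cong₂ _-_ (ℤP.pos-* c m) (ℤP.pos-* c n) ⟨
  + (c * m) - + (c * n)                  ∎
  where open ≡-Reasoning

isEll-factor : ∀ n x y d → + x - + y ≡ + (10 ^ n) ℤ.* d → ¬ (+ 10 ∣ᵤ d) → IsEll x y n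
isEll-factor n x y d x-y≡ 10∤d = agree , maximal
  where
  ∣x-y∣≡ : ℤ.∣ + x - + y ∣ ≡ 10 ^ n * ℤ.∣ d ∣
  ∣x-y∣≡ = trans (cong ℤ.∣_∣ x-y≡) (ℤP.abs-* (+ (10 ^ n)) d)

  agree : AgreeMod n x y
  agree = subst (10 ^ n ∣_) (sym ∣x-y∣≡) (m∣m*n ℤ.∣ d ∣)

  maximal : ∀ m → AgreeMod m x y → m ≤ n
  maximal m 10^m∣x-y with m ≤? n
  ... | yes m≤n = m≤n
  ... | no  m≰n = ⊥-elim (10∤d (*-cancelˡ-∣ (10 ^ n) {{m^n≢0 10 n}} (begin
    10 ^ n * 10           ≡⟨ *-comm (10 ^ n) 10 ⟩
    10 ^ suc n            ∣⟨ ^-monoʳ-∣ 10 (≰⇒> m≰n) ⟩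
    10 ^ m                ∣⟨ 10^m∣x-y ⟩
    ℤ.∣ + x - + y ∣       ≡⟨ ∣x-y∣≡ ⟩
    10 ^ n * ℤ.∣ d ∣      ∎)))
    where open ∣-Reasoning

-- The exponent ^(k-1) a in ^k a = a ^ ^(k-1) a, with ^(-1) a := 0 so that ^0 a = a ^ 0.
tetExponent : ℕ → ℕ → ℕ
tetExponent a zero    = 0
tetExponent a (suc k) = tet k a

tet≡^tetExponent : ∀ a k → tet k a ≡ a ^ tetExponent a k
tet≡^tetExponent a zero    = refl
tet≡^tetExponent a (suc k) = refl

tetExponent-< : ∀ a → 1 < a → ∀ k → tetExponent a k < tetExponent a (suc k)
tetExponent-< a 1<a zero    = s≤s z≤n
tetExponent-< a 1<a (suc k) = n<m^n a 1<a (tet k a)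

isV-from-isEll : ∀ a (ℓ : ℕ → ℕ) → (∀ k → IsEll (tet k a) (tet (suc k) a) (ℓ k)) →
                 ∀ b → IsV a (suc b) (+ ℓ (suc b) - + ℓ b)
isV-from-isEll a ℓ isEll-ℓ b = ℓ (suc b) , ℓ b , isEll-ℓ (suc b) , isEll-ℓ b , refl

0^n≤1 : ∀ n → 0 ^ n ≤ 1
0^n≤1 zero    = ≤-refl
0^n≤1 (suc n) = z≤n

tet-0≤1 : ∀ k → tet k 0 ≤ 1
tet-0≤1 zero    = ≤-refl
tet-0≤1 (suc k) = 0^n≤1 (tet k 0)

∣n-0^n∣≡1 : ∀ {n} → n ≤ 1 → ℤ.∣ + n - + (0 ^ n) ∣ ≡ 1
∣n-0^n∣≡1 z≤n       = refl
∣n-0^n∣≡1 (s≤s z≤n) = refl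

isEll-tet-0 : ∀ k → IsEll (tet k 0) (tet (suc k) 0) 0
isEll-tet-0 k = isEll-factor 0 (tet k 0) (tet (suc k) 0) d (sym (ℤP.*-identityˡ d))
                  (λ 10∣d → >⇒∤ (s≤s (s≤s z≤n)) (subst (10 ∣_) (∣n-0^n∣≡1 (tet-0≤1 k)) 10∣d))
  where d = + tet k 0 - + tet (suc k) 0

module ShiftedBase (j c : ℕ) (10∤j : ¬ 10 ∣ j) (1≤c : 1 ≤ c) where

  a : ℕ
  a = j * 10 ^ c

  10∣a : 10 ∣ a
  10∣a = ∣n⇒∣m*n j (∣-trans (divides 1 refl) (^-monoʳ-∣ 10 1≤c))

  1<a : 1 < a
  1<a = <-≤-trans (s≤s (s≤s z≤n)) (*-mono-≤ 1≤j (^-monoʳ-≤ 10 1≤c))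
    where
    1≤j : 1 ≤ j
    1≤j = n≢0⇒n>0 (λ j≡0 → 10∤j (subst (10 ∣_) (sym j≡0) (10 ∣0)))

  10∣a^n : ∀ {n} → 0 < n → 10 ∣ a ^ n
  10∣a^n {suc n} _ = ∣m⇒∣m*n (a ^ n) 10∣a

  a^S≡ : ∀ S → a ^ S ≡ 10 ^ (c * S) * j ^ S
  a^S≡ S = begin
    (j * 10 ^ c) ^ S     ≡⟨ ^-distribʳ-* j (10 ^ c) S ⟩
    j ^ S * (10 ^ c) ^ S ≡⟨ cong (j ^ S *_) (^-*-assoc 10 c S) ⟩
    j ^ S * 10 ^ (c * S) ≡⟨ *-comm (j ^ S) _ ⟩
    10 ^ (c * S) * j ^ S ∎
    where open ≡-Reasoning

  isEll-^ : ∀ {S T} → S < T → IsEll (a ^ S) (a ^ T) (c * S)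
  isEll-^ {S} {T} S<T =
    isEll-factor (c * S) (a ^ S) (a ^ T) (+ j ^ S - + q) a^S-a^T≡
      (∤-minus-multiple (10∤j ∘ 10∣m^n⇒10∣m j S) (∣n⇒∣m*n (j ^ S) (10∣a^n (m<n⇒0<n∸m S<T))))
    where
    q : ℕ
    q = j ^ S * a ^ (T ∸ S)

    a^T≡ : a ^ T ≡ 10 ^ (c * S) * q
    a^T≡ = begin
      a ^ T                                ≡⟨ cong (a ^_) (m+[n∸m]≡n (<⇒≤ S<T)) ⟨
      a ^ (S + (T ∸ S))                    ≡⟨ ^-distribˡ-+-* a S (T ∸ S) ⟩
      a ^ S * a ^ (T ∸ S)                  ≡⟨ cong (_* a ^ (T ∸ S)) (a^S≡ S) ⟩
      10 ^ (c * S) * j ^ S * a ^ (T ∸ S)   ≡⟨ *-assoc (10 ^ (c * S)) (j ^ S) _ ⟩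
      10 ^ (c * S) * q                     ∎
      where open ≡-Reasoning

    a^S-a^T≡ : + (a ^ S) - + (a ^ T) ≡ + (10 ^ (c * S)) ℤ.* (+ j ^ S - + q)
    a^S-a^T≡ = trans (cong₂ (λ x y → + x - + y) (a^S≡ S) a^T≡)
                     (sym (pos-*-distribˡ-minus (10 ^ (c * S)) (j ^ S) q))

  isEll-tet : ∀ k → IsEll (tet k a) (tet (suc k) a) (c * tetExponent a k)
  isEll-tet k = subst (λ x → IsEll x (tet (suc k) a) (c * tetExponent a k))
                      (sym (tet≡^tetExponent a k)) (isEll-^ (tetExponent-< a 1<a k))

Vformula-suc : ∀ j c b → Vformula (suc j) c (suc b) ≡
  + c ℤ.* (+ tetExponent (suc j * 10 ^ c) (suc b) - + tetExponent (suc j * 10 ^ c) b)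
Vformula-suc j c zero     = sym (ℤP.*-identityʳ (+ c))
Vformula-suc j c (suc b)  = refl

mainTheorem1 : (j c b : ℕ) → (j ≡ 0 ⊎ ¬ (10 ∣ j)) → 1 ≤ c → 1 ≤ b →
    IsV (j * 10 ^ c) b (Vformula j c b)
mainTheorem1 zero     c (suc b) _           _   _ = isV-from-isEll 0 (λ _ → 0) isEll-tet-0 b
mainTheorem1 (suc j') c (suc b) (inj₁ ())   _   _
mainTheorem1 (suc j') c (suc b) (inj₂ 10∤j) 1≤c _ =
  subst (IsV a (suc b)) V≡ (isV-from-isEll a (λ k → c * tetExponent a k) isEll-tet b)
  where
  open ShiftedBase (suc j') c 10∤j 1≤c
  V≡ : + (c * tetExponent a (suc b)) - + (c * tetExponent a b) ≡ Vformula (suc j') c (suc b)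
  V≡ = trans (sym (pos-*-distribˡ-minus c _ _)) (sym (Vformula-suc j' c b))
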